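{- Let $n\ge 2$ be an integer and set $k=\lfloor \log_2 n\rfloor$. Let $v(n)$ be the maximum, over all tournaments $T$ on $n$ vertices, of $v(T)$. Then $v(n)\le n-k$ if $n$ and $k$ have different parity, and $v(n)\le n-k+1$ otherwise.
   Context: Let $A$ be a finite set of $n$ candidates. A voter is a linear order (strict ranking) of $A$, i.e. a permutation $x_1x_2\cdots x_n$ of $A$, where $x_i$ is preferred over $x_j$ iff $i<j$. A nonempty finite multiset $U$ of voters generates a tournament $T$ on vertex set $A$ if for every pair of distinct $a,b\in A$, the arc $(a,b)$ is in $T$ if and only if strictly more than half of the voters in $U$ prefer $a$ over $b$. For a tournament $T$, $v(T)$ is the minimum cardinality of a multiset of voters generating $T$ (such a multiset always exists). -}

module Defs where

open import Data.Nat using (ℕ; zero; suc; _+_; _*_; _<_; _≤_)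
open import Data.Fin using (Fin; toℕ)
open import Data.Fin.Permutation using (Permutation′; _⟨$⟩ʳ_)
open import Data.Bool using (Bool; true; false)
open import Data.List using (List; length; filter)
open import Data.Product using (_×_)
open import Relation.Binary.PropositionalEquality using (_≡_; _≢_)
open import Relation.Nullary using (¬_)
open import Function.Bundles using (_⇔_)
import Data.Fin as F

-- A voter on candidate set Fin n: a permutation giving, for each candidate a,
-- its position (rank) in the voter's linear order (position 0 = most preferred).
Voter : ℕ → Set
Voter n = Permutation′ n

rank : ∀ {n} → Voter n → Fin n → Fin n
rank σ a = σ ⟨$⟩ʳ a

Prefers : ∀ {n} → Voter n → Fin n → Fin n → Set
Prefers σ a b = rank σ a F.< rank σ b

count : ∀ {n} → List (Voter n) → Fin n → Fin n → ℕ
count U a b = length (filter (λ σ → rank σ a F.<? rank σ b) U)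

record Tournament (n : ℕ) : Set where
  field
    arc      : Fin n → Fin n → Bool
    irrefl   : ∀ a → arc a a ≡ false
    complete : ∀ a b → a ≢ b → arc a b ≡ true → arc b a ≡ false
    total    : ∀ a b → a ≢ b → arc a b ≡ false → arc b a ≡ true
open Tournament public

Generates : ∀ {n} → List (Voter n) → Tournament n → Set
Generates U T =
  (0 < length U) ×
  (∀ a b → a ≢ b → (arc T a b ≡ true) ⇔ (length U < 2 * count U a b))

module Submission where

-- Write n - r = j + 1, where 2^j ≤ n and r is even.  Every tournament T on n
-- vertices contains a transitive subtournament on j + 1 vertices (split the
-- vertices by whether a fixed vertex v beats them; the larger half has size
-- ≥ 2^(j-1) and recursion applies there, with v on top or at the bottom).  A
-- single voter realises T on that part.  The remaining r vertices are absorbed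
-- two at a time: with x → y, all existing voters are modified (x ≻ y moved to the
-- top in one half U₁, to the bottom in the other half U₂) and two new voters are
-- added, ordered according to the arcs between {x, y} and the absorbed vertices.
-- The invariant is |U₂| = |U₁| + 1 with a strict majority on every arc among
-- the absorbed vertices.  This yields 1 + r = n - j voters; taking j = ⌊log₂ n⌋
-- or j = ⌊log₂ n⌋ - 1 according to parity gives the theorem.
--
-- Voters are handled as scores Fin n → ℕ (ties broken by the candidate index)
-- and converted to permutations only at the very end.

open import Defs
open import Data.Nat using (ℕ; zero; suc; _+_; _*_; _∸_; _^_; _≤_; _<_; _%_; z≤n; s≤s; _<?_; _≤?_; ⌊_/2⌋; ⌈_/2⌉)
open import Data.Nat.Logarithm using (⌊log₂_⌋; ⌊log₂⌊n/2⌋⌋≡⌊log₂n⌋∸1; ⌊log₂⌋-mono-≤)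
open import Data.Nat.Induction using (<-wellFounded)
open import Induction.WellFounded using (Acc; acc)
open import Data.Nat.Properties
open import Algebra.Properties.CommutativeSemigroup +-commutativeSemigroup
  using () renaming (interchange to +-interchange)
open import Data.Fin using (Fin; toℕ; fromℕ<)
import Data.Fin as F
import Data.Fin.Properties as FP
open import Data.Fin.Subset using (Subset; inside; outside; ⊤; ∣_∣; _⊂_) renaming (_∈_ to _∈ₛ_)
open import Data.Fin.Subset.Properties using (∈⊤; ⊆⊤; ∣⊤∣≡n; p⊂q⇒∣p∣<∣q∣)
open import Data.Fin.Permutation using (permutation)
open import Data.Vec using (tabulate)
open import Data.Vec.Properties using (lookup∘tabulate; []=⇒lookup; lookup⇒[]=)
open import Data.Bool using (Bool; true; false)
import Data.Bool as Bool
open import Data.Bool.Properties using (¬-not)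
open import Data.Empty using (⊥-elim)
open import Data.Sum using (_⊎_; inj₁; inj₂)
open import Data.Product using (∃; _×_; _,_; proj₁; proj₂; map₂)
open import Data.List using (List; []; _∷_; length; _++_; map; allFin; filter)
open import Data.List.Properties using (filter-accept; filter-reject; ++-assoc; length-++; length-map; length-tabulate)
open import Data.List.Membership.Propositional using (_∈_; _∉_)
open import Data.List.Relation.Unary.Any using (here; there)
open import Data.List.Relation.Binary.Permutation.Propositional using (_↭_; ↭-refl; ↭-prep; ↭-swap; ↭-trans; ↭-reflexive; ↭-sym; ↭⇒↭ₛ)
open import Data.List.Relation.Binary.Permutation.Propositional.Properties using (∈-resp-↭; ++⁺ʳ; shift; shifts; ++-comm; ↭-length)
import Data.List.Relation.Binary.Permutation.Setoid.Properties as SetoidPermutation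
open import Data.List.Extrema.Nat using (max; xs≤max)
import Data.List.Relation.Unary.All as All
import Data.List.Relation.Unary.All.Properties as All
open import Data.List.Membership.Propositional.Properties using (∈-allFin; ∈-++⁺ˡ; ∈-filter⁻)
open import Function using (_∘_; id)
open import Function.Definitions using (Injective)
open import Function.Bundles using (mk⇔)
open import Relation.Binary.PropositionalEquality
open import Relation.Binary.Definitions using (tri<; tri≈; tri>)
open import Relation.Nullary using (¬_; Dec; yes; no)
open import Relation.Unary using (Decidable)
open import Relation.Unary.Properties using (∁?)
open import Data.List.Relation.Unary.Unique.Propositional using (Unique; _∷_)
import Data.List.Relation.Unary.Unique.Propositional.Properties as Unique
open import Relation.Nullary.Negation using (contradiction)

private
  variable
    n : ℕ

-- A voter given by scores: lower score means more preferred.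
Score : ℕ → Set
Score n = Fin n → ℕ

-- Scores refined into a strict order by breaking ties with the candidate index.
key : Score n → Fin n → ℕ
key {n} g z = g z * n + toℕ z

record Above (g : Score n) (a b : Fin n) : Set where
  constructor ranked
  field key< : key g a < key g b
open Above

above-asym : {g : Score n} {a b : Fin n} → Above g a b → ¬ Above g b a
above-asym (ranked ab) (ranked ba) = <-asym ab ba

key-lower : (g : Score n) (z : Fin n) → g z * n ≤ key g z
key-lower g z = m≤m+n _ _

key-upper : (g : Score n) (z : Fin n) → key g z < suc (g z) * n
key-upper {n} g z = begin-strict
    g z * n + toℕ z  <⟨ +-monoʳ-< (g z * n) (FP.toℕ<n z) ⟩
    g z * n + n      ≡⟨ +-comm (g z * n) n ⟩
    suc (g z) * n    ∎
  where open ≤-Reasoning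

score-above : (g : Score n) (a b : Fin n) → g a < g b → Above g a b
score-above {n} g a b lt = ranked (begin-strict
    key g a        <⟨ key-upper g a ⟩
    suc (g a) * n  ≤⟨ *-monoˡ-≤ n lt ⟩
    g b * n        ≤⟨ key-lower g b ⟩
    key g b        ∎)
  where open ≤-Reasoning

key-injective : (g : Score n) {a b : Fin n} → key g a ≡ key g b → a ≡ b
key-injective g {a} {b} eq with <-cmp (g a) (g b)
... | tri< lt _ _ = contradiction eq (<⇒≢ (key< (score-above g a b lt)))
... | tri> _ _ gt = contradiction (sym eq) (<⇒≢ (key< (score-above g b a gt)))
... | tri≈ _ same _ = FP.toℕ-injective (+-cancelˡ-≡ (g a * _) _ _
        (trans eq (cong (λ s → s * _ + toℕ b) (sym same))))

above-total : (g : Score n) {a b : Fin n} → a ≢ b → Above g a b ⊎ Above g b a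
above-total g {a} {b} a≢b with <-cmp (key g a) (key g b)
... | tri< lt _ _ = inj₁ (ranked lt)
... | tri> _ _ gt = inj₂ (ranked gt)
... | tri≈ _ eq _ = contradiction (key-injective g eq) a≢b

vote : Score n → Fin n → Fin n → ℕ
vote g a b with key g a <? key g b
... | yes _ = 1
... | no _ = 0

vote-yes : (g : Score n) {a b : Fin n} → Above g a b → vote g a b ≡ 1
vote-yes g {a} {b} above with key g a <? key g b
... | yes _ = refl
... | no ¬above = contradiction (key< above) ¬above

vote-no : (g : Score n) {a b : Fin n} → ¬ Above g a b → vote g a b ≡ 0
vote-no g {a} {b} ¬above with key g a <? key g b
... | yes above = contradiction (ranked above) ¬above
... | no _ = refl

vote-complement : (g : Score n) {a b : Fin n} → a ≢ b → vote g a b + vote g b a ≡ 1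
vote-complement g a≢b with above-total g a≢b
... | inj₁ ab rewrite vote-yes g ab | vote-no g (above-asym ab) = refl
... | inj₂ ba rewrite vote-no g (above-asym ba) | vote-yes g ba = refl

votes : List (Score n) → Fin n → Fin n → ℕ
votes []      a b = 0
votes (g ∷ U) a b = vote g a b + votes U a b

votes-++ : (U V : List (Score n)) (a b : Fin n) → votes (U ++ V) a b ≡ votes U a b + votes V a b
votes-++ []      V a b = refl
votes-++ (g ∷ U) V a b = trans (cong (vote g a b +_) (votes-++ U V a b)) (sym (+-assoc (vote g a b) _ _))

votes-complement : (U : List (Score n)) {a b : Fin n} → a ≢ b → votes U a b + votes U b a ≡ length U
votes-complement []      a≢b = refl
votes-complement (g ∷ U) {a} {b} a≢b =
  trans (+-interchange (vote g a b) (votes U a b) (vote g b a) (votes U b a))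
        (cong₂ _+_ (vote-complement g a≢b) (votes-complement U a≢b))

Respects : (Score n → Score n) → Fin n → Fin n → Set
Respects f a b = ∀ g → Above g a b → Above (f g) a b

vote-respected : (f : Score n → Score n) {a b : Fin n} → a ≢ b → Respects f a b → Respects f b a →
  (g : Score n) → vote (f g) a b ≡ vote g a b
vote-respected f a≢b fab fba g with above-total g a≢b
... | inj₁ ab = trans (vote-yes (f g) (fab g ab)) (sym (vote-yes g ab))
... | inj₂ ba = trans (vote-no (f g) (above-asym (fba g ba))) (sym (vote-no g (above-asym ba)))

votes-respected : (f : Score n → Score n) {a b : Fin n} → a ≢ b → Respects f a b → Respects f b a →
  (U : List (Score n)) → votes (map f U) a b ≡ votes U a b
votes-respected f a≢b fab fba []      = refl
votes-respected f a≢b fab fba (g ∷ U) =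
  cong₂ _+_ (vote-respected f a≢b fab fba g) (votes-respected f a≢b fab fba U)

votes-unanimous : (f : Score n → Score n) {a b : Fin n} → (∀ g → Above (f g) a b) →
  (U : List (Score n)) → votes (map f U) a b ≡ length U
votes-unanimous f all []      = refl
votes-unanimous f all (g ∷ U) = cong₂ _+_ (vote-yes (f g) (all g)) (votes-unanimous f all U)

put : Fin n → ℕ → (Fin n → ℕ) → Score n
put v c f z with z F.≟ v
... | yes _ = c
... | no _ = f z

put-here : {v : Fin n} {c : ℕ} {f : Fin n → ℕ} → put v c f v ≡ c
put-here {v = v} with v F.≟ v
... | yes _ = refl
... | no v≢v = contradiction refl v≢v

put-there : {v z : Fin n} {c : ℕ} {f : Fin n → ℕ} → z ≢ v → put v c f z ≡ f z
put-there {v = v} {z} z≢v with z F.≟ v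
... | yes z≡v = contradiction z≡v z≢v
... | no _ = refl

raise : Fin n → Score n → Score n
raise v g = put v 0 (suc ∘ key g)

raise-top : (v : Fin n) (g : Score n) {z : Fin n} → z ≢ v → Above (raise v g) v z
raise-top v g {z} z≢v =
  score-above (raise v g) v z (subst₂ _<_ (sym (put-here {v = v})) (sym (put-there z≢v)) (s≤s z≤n))

raise-respects : (v : Fin n) {a b : Fin n} → a ≢ v → b ≢ v → Respects (raise v) a b
raise-respects v {a} {b} a≢v b≢v g ab =
  score-above (raise v g) a b (subst₂ _<_ (sym (put-there a≢v)) (sym (put-there b≢v)) (s≤s (key< ab)))

maxKey : Score n → ℕ
maxKey {n} g = max 0 (map (key g) (allFin n))

key≤maxKey : (g : Score n) (z : Fin n) → key g z ≤ maxKey g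
key≤maxKey {n} g z = All.lookup (All.map⁻ (xs≤max 0 (map (key g) (allFin n)))) (∈-allFin z)

lower : Fin n → Score n → Score n
lower v g = put v (suc (maxKey g)) (key g)

lower-bottom : (v : Fin n) (g : Score n) {z : Fin n} → z ≢ v → Above (lower v g) z v
lower-bottom v g {z} z≢v =
  score-above (lower v g) z v
    (subst₂ _<_ (sym (put-there z≢v)) (sym (put-here {v = v})) (s≤s (key≤maxKey g z)))

lower-respects : (v : Fin n) {a b : Fin n} → a ≢ v → b ≢ v → Respects (lower v) a b
lower-respects v {a} {b} a≢v b≢v g ab =
  score-above (lower v g) a b (subst₂ _<_ (sym (put-there a≢v)) (sym (put-there b≢v)) (key< ab))

side : Score n → Fin n → Fin n → Bool
side g c a with key g c <? key g a
... | yes _ = inside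
... | no _ = outside

ahead : Score n → Fin n → Subset n
ahead g a = tabulate (λ c → side g c a)

∈-ahead : (g : Score n) {a c : Fin n} → Above g c a → c ∈ₛ ahead g a
∈-ahead g {a} {c} ca = lookup⇒[]= c _ (trans (lookup∘tabulate (λ c → side g c a) c) inside-side)
  where
    inside-side : side g c a ≡ inside
    inside-side with key g c <? key g a
    ... | yes _ = refl
    ... | no ¬ca = contradiction (key< ca) ¬ca

ahead-∈ : (g : Score n) {a c : Fin n} → c ∈ₛ ahead g a → Above g c a
ahead-∈ g {a} {c} c∈ = above (trans (sym (lookup∘tabulate (λ c → side g c a) c)) ([]=⇒lookup c∈))
  where
    above : side g c a ≡ inside → Above g c a
    above eq with key g c <? key g a
    ... | yes ca = ranked ca
    ... | no _ = contradiction eq (λ ())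

position : Score n → Fin n → Fin n
position {n} g a = fromℕ< (subst (∣ ahead g a ∣ <_) (∣⊤∣≡n n) (p⊂q⇒∣p∣<∣q∣ ahead⊂⊤))
  where
    ahead⊂⊤ : ahead g a ⊂ ⊤
    ahead⊂⊤ = ⊆⊤ , a , ∈⊤ , λ a∈ → <-irrefl refl (key< (ahead-∈ g a∈))

position-mono : (g : Score n) {a b : Fin n} → Above g a b → position g a F.< position g b
position-mono g {a} {b} ab =
  subst₂ _<_ (sym (FP.toℕ-fromℕ< _)) (sym (FP.toℕ-fromℕ< _)) (p⊂q⇒∣p∣<∣q∣ ahead⊂ahead)
  where
    ahead⊂ahead : ahead g a ⊂ ahead g b
    ahead⊂ahead = (λ c∈ → ∈-ahead g (ranked (<-trans (key< (ahead-∈ g c∈)) (key< ab))))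
                , a , ∈-ahead g ab , λ a∈ → <-irrefl refl (key< (ahead-∈ g a∈))

position-injective : (g : Score n) {a b : Fin n} → position g a ≡ position g b → a ≡ b
position-injective g {a} {b} eq with a F.≟ b
... | yes a≡b = a≡b
... | no a≢b with above-total g a≢b
...   | inj₁ ab = contradiction (cong toℕ eq) (<⇒≢ (position-mono g ab))
...   | inj₂ ba = contradiction (cong toℕ (sym eq)) (<⇒≢ (position-mono g ba))

injective⇒surjective : (f : Fin n → Fin n) → Injective _≡_ _≡_ f → (p : Fin n) → ∃ λ a → f a ≡ p
injective⇒surjective {suc m} f f-injective p with FP.any? (λ a → f a F.≟ p)
... | yes hit = hit
... | no miss = ⊥-elim (FP.<⇒notInjective (n<1+n m) squeeze-injective)
  where
    squeeze : Fin (suc m) → Fin m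
    squeeze a = F.punchOut {i = p} {j = f a} (λ p≡fa → miss (a , sym p≡fa))
    squeeze-injective : Injective _≡_ _≡_ squeeze
    squeeze-injective eq = f-injective (FP.punchOut-injective {i = p} _ _ eq)

-- The permutation associated with a score voter.  It is kept abstract: only
-- the fact that it orders candidates exactly like the score is used.
abstract
  toVoter : Score n → Voter n
  toVoter g = permutation (position g) (λ p → proj₁ (onto p)) (λ p → proj₂ (onto p))
                          (λ a → position-injective g (proj₂ (onto (position g a))))
    where
      onto : ∀ p → ∃ λ a → position g a ≡ p
      onto = injective⇒surjective (position g) (position-injective g)

  toVoter-prefers : (g : Score n) {a b : Fin n} → Above g a b → Prefers (toVoter g) a b
  toVoter-prefers g = position-mono g

  toVoter-reflects : (g : Score n) {a b : Fin n} → Prefers (toVoter g) a b → Above g a b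
  toVoter-reflects g {a} {b} pos with a F.≟ b
  ... | yes refl = contradiction pos (<-irrefl refl)
  ... | no a≢b with above-total g a≢b
  ...   | inj₁ ab = ab
  ...   | inj₂ ba = contradiction pos (<⇒≯ (position-mono g ba))

prefers? : (a b : Fin n) → Decidable (λ σ → Prefers σ a b)
prefers? a b σ = rank σ a F.<? rank σ b

count-toVoter : (U : List (Score n)) (a b : Fin n) → count (map toVoter U) a b ≡ votes U a b
count-toVoter []      a b = refl
count-toVoter (g ∷ U) a b with key g a <? key g b
... | yes ab = trans (cong length (filter-accept (prefers? a b) (toVoter-prefers g (ranked ab))))
                     (cong suc (count-toVoter U a b))
... | no ¬ab = trans (cong length (filter-reject (prefers? a b) (¬ab ∘ key< ∘ toVoter-reflects g)))
                     (count-toVoter U a b)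

module _ (T : Tournament n) where

  arc-irreflexive : {a b : Fin n} → arc T a b ≡ true → a ≢ b
  arc-irreflexive {a} ab refl = contradiction (trans (sym ab) (irrefl T a)) λ ()

  arc-asymmetric : {a b : Fin n} → arc T a b ≡ true → arc T b a ≢ true
  arc-asymmetric {a} {b} ab ba = contradiction (trans (sym ba) (complete T a b (arc-irreflexive ab) ab)) λ ()

  arc-converse : {a b : Fin n} → a ≢ b → arc T a b ≢ true → arc T b a ≡ true
  arc-converse {a} {b} a≢b ¬ab = total T a b a≢b (¬-not ¬ab)

  beaten? : (v : Fin n) → Decidable (λ z → arc T v z ≡ true)
  beaten? v z = arc T v z Bool.≟ true

  record TransitivePart (L : List (Fin n)) (size : ℕ) : Set where
    field
      chosen others : List (Fin n)
      voter : Score n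
      splits : chosen ++ others ↭ L
      chosen-size : length chosen ≡ size
      agrees : {a b : Fin n} → a ∈ chosen → b ∈ chosen → arc T a b ≡ true → Above voter a b

    chosen⊆ : {a : Fin n} → a ∈ chosen → a ∈ L
    chosen⊆ a∈ = ∈-resp-↭ splits (∈-++⁺ˡ a∈)

  open TransitivePart

  splits-extend : {v : Fin n} (C O : List (Fin n)) {M N L : List (Fin n)} →
    C ++ O ↭ M → M ++ N ↭ L → (v ∷ C) ++ (O ++ N) ↭ v ∷ L
  splits-extend C O {N = N} C++O↭M M++N↭L =
    ↭-prep _ (↭-trans (↭-reflexive (sym (++-assoc C O N))) (↭-trans (++⁺ʳ N C++O↭M) M++N↭L))

  extend-top : (v : Fin n) {M N L : List (Fin n)} {s : ℕ} → (∀ {z} → z ∈ M → arc T v z ≡ true) →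
    M ++ N ↭ L → TransitivePart M s → TransitivePart (v ∷ L) (suc s)
  extend-top v {N = N} beaten M++N↭L P = record
    { chosen = v ∷ chosen P ; others = others P ++ N ; voter = raise v (voter P)
    ; splits = splits-extend (chosen P) (others P) (splits P) M++N↭L
    ; chosen-size = cong suc (chosen-size P) ; agrees = agrees′ }
    where
      ≢v : {a : Fin n} → a ∈ chosen P → a ≢ v
      ≢v a∈ = arc-irreflexive (beaten (chosen⊆ P a∈)) ∘ sym
      agrees′ : {a b : Fin n} → a ∈ v ∷ chosen P → b ∈ v ∷ chosen P → arc T a b ≡ true →
        Above (raise v (voter P)) a b
      agrees′ (here refl) (here refl) ab = contradiction refl (arc-irreflexive ab)
      agrees′ (here refl) (there b∈) ab = raise-top v (voter P) (≢v b∈)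
      agrees′ (there a∈) (here refl) ab = contradiction (beaten (chosen⊆ P a∈)) (arc-asymmetric ab)
      agrees′ (there a∈) (there b∈) ab = raise-respects v (≢v a∈) (≢v b∈) (voter P) (agrees P a∈ b∈ ab)

  extend-bottom : (v : Fin n) {M N L : List (Fin n)} {s : ℕ} → (∀ {z} → z ∈ M → arc T v z ≢ true) →
    (∀ {z} → z ∈ M → z ≢ v) → M ++ N ↭ L → TransitivePart M s → TransitivePart (v ∷ L) (suc s)
  extend-bottom v {N = N} unbeaten ≢v M++N↭L P = record
    { chosen = v ∷ chosen P ; others = others P ++ N ; voter = lower v (voter P)
    ; splits = splits-extend (chosen P) (others P) (splits P) M++N↭L
    ; chosen-size = cong suc (chosen-size P) ; agrees = agrees′ }
    where
      agrees′ : {a b : Fin n} → a ∈ v ∷ chosen P → b ∈ v ∷ chosen P → arc T a b ≡ true →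
        Above (lower v (voter P)) a b
      agrees′ (here refl) (here refl) ab = contradiction refl (arc-irreflexive ab)
      agrees′ (here refl) (there b∈) ab = contradiction ab (unbeaten (chosen⊆ P b∈))
      agrees′ (there a∈) (here refl) ab = lower-bottom v (voter P) (≢v (chosen⊆ P a∈))
      agrees′ (there a∈) (there b∈) ab =
        lower-respects v (≢v (chosen⊆ P a∈)) (≢v (chosen⊆ P b∈)) (voter P) (agrees P a∈ b∈ ab)

unique-resp-↭ : {A : Set} {xs ys : List A} → xs ↭ ys → Unique xs → Unique ys
unique-resp-↭ xs↭ys = SetoidPermutation.Unique-resp-↭ (setoid _) (↭⇒↭ₛ xs↭ys)

filter-partition-↭ : {A : Set} {P : A → Set} (P? : Decidable P) (xs : List A) →
  filter P? xs ++ filter (∁? P?) xs ↭ xs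
filter-partition-↭ P? []       = ↭-refl
filter-partition-↭ P? (x ∷ xs) with P? x
... | yes _ = ↭-prep x (filter-partition-↭ P? xs)
... | no _  = ↭-trans (shift x (filter P? xs) _) (↭-prep x (filter-partition-↭ P? xs))

at-least-half : {m o i : ℕ} → 2 * m ≤ suc (o + i) → m ≤ o ⊎ m ≤ i
at-least-half {m} {o} {i} 2m≤ with m ≤? o | m ≤? i
... | yes m≤o | _       = inj₁ m≤o
... | no _    | yes m≤i = inj₂ m≤i
... | no o<m  | no i<m  = contradiction 2m≤ (<⇒≱ (begin-strict
      suc (o + i)      <⟨ s≤s (+-monoʳ-< o (n<1+n i)) ⟩
      suc o + suc i    ≤⟨ +-mono-≤ (≰⇒> o<m) (≰⇒> i<m) ⟩
      m + m            ≡⟨ cong (m +_) (sym (+-identityʳ m)) ⟩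
      2 * m            ∎))
  where open ≤-Reasoning

-- Any 2^j distinct vertices contain a transitive part with j + 1 vertices:
-- v splits the rest into the vertices it beats and the others, one of which
-- has ≥ 2^(j-1) elements; v goes on top of the first or below the second.
transitive-part : (T : Tournament n) (j : ℕ) (L : List (Fin n)) → Unique L → 2 ^ j ≤ length L →
  TransitivePart T L (suc j)
transitive-part T j [] _ 2^j≤0 = contradiction 2^j≤0 (<⇒≱ (m^n>0 2 j))
transitive-part T zero (v ∷ L) _ _ = record
  { chosen = v ∷ [] ; others = L ; voter = λ _ → 0 ; splits = ↭-refl ; chosen-size = refl
  ; agrees = λ { (here refl) (here refl) vv → contradiction refl (arc-irreflexive T vv) } }
transitive-part T (suc j) (v ∷ L) (v∉L ∷ unique) 2^j+1≤
  with at-least-half {o = length beaten} (subst (2 ^ suc j ≤_) (cong suc (sym sizes)) 2^j+1≤)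
  where
    beaten = filter (beaten? T v) L
    unbeaten = filter (∁? (beaten? T v)) L
    sizes : length beaten + length unbeaten ≡ length L
    sizes = trans (sym (length-++ beaten)) (↭-length (filter-partition-↭ (beaten? T v) L))
... | inj₁ many-beaten = extend-top T v (proj₂ ∘ ∈-filter⁻ (beaten? T v) {xs = L})
        (filter-partition-↭ (beaten? T v) L)
        (transitive-part T j _ (Unique.filter⁺ (beaten? T v) unique) many-beaten)
... | inj₂ many-unbeaten = extend-bottom T v (proj₂ ∘ ∈-filter⁻ (∁? (beaten? T v)) {xs = L})
        (λ z∈ z≡v → All.lookup v∉L (proj₁ (∈-filter⁻ (∁? (beaten? T v)) {xs = L} z∈)) (sym z≡v))
        (↭-trans (++-comm (filter (∁? (beaten? T v)) L) _) (filter-partition-↭ (beaten? T v) L))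
        (transitive-part T j _ (Unique.filter⁺ (∁? (beaten? T v)) unique) many-unbeaten)

-- The score of a vertex z ∉ {x, y} in the first voter added for the pair
-- x → y, determined by the arcs between z and x, y:  x→z→y : 1,  x→z, y→z : 3,
-- z→x, y→z : 4,  z→x, z→y : 5.
layer : Bool → Bool → ℕ
layer true  false = 1
layer true  true  = 3
layer false true  = 4
layer false false = 5

layer-≥1 : ∀ p q → 1 ≤ layer p q
layer-≥1 true  false = s≤s z≤n
layer-≥1 true  true  = s≤s z≤n
layer-≥1 false true  = s≤s z≤n
layer-≥1 false false = s≤s z≤n

layer-<6 : ∀ p q → layer p q < 6
layer-<6 true  false = s≤s (s≤s z≤n)
layer-<6 true  true  = s≤s (s≤s (s≤s (s≤s z≤n)))
layer-<6 false true  = s≤s (s≤s (s≤s (s≤s (s≤s z≤n))))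
layer-<6 false false = ≤-refl

layer-true-<4 : ∀ q → layer true q < 4
layer-true-<4 false = s≤s (s≤s z≤n)
layer-true-<4 true  = ≤-refl

layer-false-≥4 : ∀ q → 4 ≤ layer false q
layer-false-≥4 true  = ≤-refl
layer-false-≥4 false = s≤s (s≤s (s≤s (s≤s z≤n)))

layer-when-y-beats : ∀ p → 2 < layer p true × layer p true < 5
layer-when-y-beats true  = ≤-refl , s≤s (s≤s (s≤s (s≤s z≤n)))
layer-when-y-beats false = s≤s (s≤s (s≤s z≤n)) , ≤-refl

-- In the second new voter the other candidates z get the even score
-- 2 (6n - key first z), reversing the first voter; cut n c is the odd score of a
-- candidate inserted between the keys below c and the keys from c on.
cut : ℕ → ℕ → ℕ
cut n c = suc (2 * (6 * n ∸ c))

cut-below : (n : ℕ) {k c : ℕ} → k < c → c ≤ 6 * n → cut n c < 2 * (6 * n ∸ k)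
cut-below n {k} {c} k<c c≤6n = begin-strict
    suc (2 * (6 * n ∸ c))    <⟨ n<1+n _ ⟩
    suc (suc (2 * (6 * n ∸ c))) ≡⟨ sym (*-suc 2 (6 * n ∸ c)) ⟩
    2 * suc (6 * n ∸ c)      ≤⟨ *-monoʳ-≤ 2 (∸-monoʳ-< k<c c≤6n) ⟩
    2 * (6 * n ∸ k)          ∎
  where open ≤-Reasoning

cut-above : (n : ℕ) {k c : ℕ} → c ≤ k → 2 * (6 * n ∸ k) < cut n c
cut-above n c≤k = s≤s (*-monoʳ-≤ 2 (∸-monoʳ-≤ (6 * n) c≤k))

module _ (T : Tournament n) (x y : Fin n) where

  level : Fin n → ℕ
  level z = layer (arc T x z) (arc T y z)

  -- x ≻ layer 1 ≻ y ≻ layer 3 ≻ layer 4 ≻ layer 5.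
  first : Score n
  first = put x 0 (put y 2 level)

  reversed : Fin n → ℕ
  reversed z = 2 * (6 * n ∸ key first z)

  -- layer 5 ≻ y ≻ layer 4 ≻ x ≻ layer 3 ≻ layer 1, each layer reversed.
  second : Score n
  second = put x (cut n (4 * n)) (put y (cut n (5 * n)) reversed)

  promote : Score n → Score n
  promote = raise x ∘ raise y

  demote : Score n → Score n
  demote = lower y ∘ lower x

  first-x : first x ≡ 0
  first-x = put-here {v = x} {c = 0} {f = put y 2 level}

  second-x : second x ≡ cut n (4 * n)
  second-x = put-here {v = x} {c = cut n (4 * n)} {f = put y (cut n (5 * n)) reversed}

  module _ (x≢y : x ≢ y) where

    first-y : first y ≡ 2
    first-y = trans (put-there {v = x} {c = 0} {f = put y 2 level} (x≢y ∘ sym))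
                    (put-here {v = y} {c = 2} {f = level})

    second-y : second y ≡ cut n (5 * n)
    second-y = trans (put-there {v = x} {c = cut n (4 * n)} (x≢y ∘ sym))
                     (put-here {v = y} {c = cut n (5 * n)} {f = reversed})

    first-x-above-y : Above first x y
    first-x-above-y = score-above first x y (subst₂ _<_ (sym first-x) (sym first-y) (s≤s z≤n))

    module _ {z : Fin n} (z≢x : z ≢ x) (z≢y : z ≢ y) where

      first-other : first z ≡ level z
      first-other = trans (put-there {v = x} {c = 0} {f = put y 2 level} z≢x)
                          (put-there {v = y} {c = 2} {f = level} z≢y)

      second-other : second z ≡ reversed z
      second-other = trans (put-there {v = x} {c = cut n (4 * n)} z≢x)
                           (put-there {v = y} {c = cut n (5 * n)} {f = reversed} z≢y)

      key-first-upper : {c : ℕ} → level z < c → key first z < c * n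
      key-first-upper {c} L<c =
        <-≤-trans (key-upper first z) (*-monoˡ-≤ n (subst (_< c) (sym first-other) L<c))

      key-first-lower : {c : ℕ} → c ≤ level z → c * n ≤ key first z
      key-first-lower {c} c≤L =
        ≤-trans (*-monoˡ-≤ n (subst (c ≤_) (sym first-other) c≤L)) (key-lower first z)

      first-x-above : Above first x z
      first-x-above = score-above first x z
        (subst₂ _<_ (sym first-x) (sym first-other) (layer-≥1 (arc T x z) (arc T y z)))

      second-x-above : arc T x z ≡ true → Above second x z
      second-x-above xz = score-above second x z (subst₂ _<_ (sym second-x) (sym second-other)
        (cut-below n (key-first-upper (subst (λ p → layer p (arc T y z) < 4) (sym xz) (layer-true-<4 _)))
                   (*-monoˡ-≤ n (m≤m+n 4 2))))

      second-x-below : arc T x z ≡ false → Above second z x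
      second-x-below zx = score-above second z x (subst₂ _<_ (sym second-other) (sym second-x)
        (cut-above n (key-first-lower (subst (λ p → 4 ≤ layer p (arc T y z)) (sym zx) (layer-false-≥4 _)))))

      y-above : arc T y z ≡ true → Above first y z × Above second y z
      y-above yz = score-above first y z (subst₂ _<_ (sym first-y) (sym first-other) 2<L)
                 , score-above second y z (subst₂ _<_ (sym second-y) (sym second-other)
                     (cut-below n (key-first-upper L<5) (*-monoˡ-≤ n (m≤m+n 5 1))))
        where
          bounds : 2 < level z × level z < 5
          bounds = subst (λ q → 2 < layer (arc T x z) q × layer (arc T x z) q < 5) (sym yz) (layer-when-y-beats _)
          2<L = proj₁ bounds
          L<5 = proj₂ bounds

      y-below : arc T y z ≡ false → Above first z y ⊎ Above second z y
      y-below zy with arc T x z in xz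
      ... | true  = inj₁ (score-above first z y (subst₂ _<_ (sym first-other) (sym first-y) L<2))
        where
          L<2 : level z < 2
          L<2 = subst (_< 2) (sym (cong₂ layer xz zy)) ≤-refl
      ... | false = inj₂ (score-above second z y
                      (subst₂ _<_ (sym second-other) (sym second-y) (cut-above n (key-first-lower 5≤L))))
        where
          5≤L : 5 ≤ level z
          5≤L = subst (5 ≤_) (sym (cong₂ layer xz zy)) ≤-refl

    second-reverses : {a b : Fin n} → a ≢ x → a ≢ y → b ≢ x → b ≢ y →
      Above first b a → Above second a b
    second-reverses {a} {b} a≢x a≢y b≢x b≢y ba = score-above second a b
      (subst₂ _<_ (sym (second-other a≢x a≢y)) (sym (second-other b≢x b≢y))
        (*-monoʳ-< 2 (∸-monoʳ-< (key< ba) (<⇒≤ (key-first-upper a≢x a≢y (layer-<6 _ _))))))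

-- The electorate U₁ ++ U₂ (with |U₂| = |U₁| + 1) has a strict majority for
-- every arc between vertices of P.
MajorityOn : Tournament n → List (Fin n) → List (Score n) → List (Score n) → Set
MajorityOn T P U₁ U₂ =
  ∀ {a b} → a ∈ P → b ∈ P → arc T a b ≡ true → length U₁ < votes U₁ a b + votes U₂ a b

module _ (T : Tournament n) {x y : Fin n} where

  promote-respects : {a b : Fin n} → a ≢ x → a ≢ y → b ≢ x → b ≢ y → Respects (promote T x y) a b
  promote-respects a≢x a≢y b≢x b≢y g ab = raise-respects x a≢x b≢x _ (raise-respects y a≢y b≢y g ab)

  demote-respects : {a b : Fin n} → a ≢ x → a ≢ y → b ≢ x → b ≢ y → Respects (demote T x y) a b
  demote-respects a≢x a≢y b≢x b≢y g ab = lower-respects y a≢y b≢y _ (lower-respects x a≢x b≢x g ab)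

-- The tally after absorbing x → y into a balanced electorate U₁, U₂ with |U₁| = m:
-- the new halves are first ∷ map promote U₁ and second ∷ map demote U₂, and a
-- strict majority now means more than m + 1 votes.
module _ (T : Tournament n) {x y : Fin n} {U₁ U₂ : List (Score n)}
         (balanced : length U₂ ≡ suc (length U₁)) where

  private
    m = length U₁
    new promoted demoted : Fin n → Fin n → ℕ
    new a b = vote (first T x y) a b + vote (second T x y) a b
    promoted = votes (map (promote T x y) U₁)
    demoted = votes (map (demote T x y) U₂)

  enough : (a b : Fin n) → suc (suc m) ≤ new a b + (promoted a b + demoted a b) →
    length (first T x y ∷ map (promote T x y) U₁) <
      votes (first T x y ∷ map (promote T x y) U₁) a b + votes (second T x y ∷ map (demote T x y) U₂) a b
  enough a b h = subst₂ _<_ (cong suc (sym (length-map (promote T x y) U₁)))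
    (+-interchange (vote (first T x y) a b) (vote (second T x y) a b) _ _) h

  one-new : (a b : Fin n) → Above (first T x y) a b ⊎ Above (second T x y) a b → 1 ≤ new a b
  one-new a b (inj₁ ab) rewrite vote-yes (first T x y) {a} {b} ab = s≤s z≤n
  one-new a b (inj₂ ab) rewrite vote-yes (second T x y) {a} {b} ab = m≤n+m 1 _

  -- Both new voters plus the unanimous promoted half: 2 + m.
  two-new-and-promoted : (a b : Fin n) → Above (first T x y) a b → Above (second T x y) a b →
    (∀ g → Above (promote T x y g) a b) → suc (suc m) ≤ new a b + (promoted a b + demoted a b)
  two-new-and-promoted a b ab₁ ab₂ unanimous
    rewrite vote-yes (first T x y) {a} {b} ab₁ | vote-yes (second T x y) {a} {b} ab₂
          | votes-unanimous (promote T x y) {a} {b} unanimous U₁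
    = s≤s (s≤s (m≤m+n m _))

  -- One new voter plus the unanimous demoted half: 1 + (m + 1).
  one-new-and-demoted : (a b : Fin n) → Above (first T x y) a b ⊎ Above (second T x y) a b →
    (∀ g → Above (demote T x y g) a b) → suc (suc m) ≤ new a b + (promoted a b + demoted a b)
  one-new-and-demoted a b some unanimous
    rewrite votes-unanimous (demote T x y) {a} {b} unanimous U₂ | balanced
    = +-mono-≤ (one-new a b some) (m≤n+m (suc m) _)

  -- Two old candidates: the old majority survives and one new voter agrees.
  old-pair : x ≢ y → {a b : Fin n} → a ≢ x → a ≢ y → b ≢ x → b ≢ y → arc T a b ≡ true →
    m < votes U₁ a b + votes U₂ a b → suc (suc m) ≤ new a b + (promoted a b + demoted a b)
  old-pair x≢y {a} {b} a≢x a≢y b≢x b≢y ab old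
    rewrite votes-respected (promote T x y) (arc-irreflexive T ab) (promote-respects T a≢x a≢y b≢x b≢y)
                            (promote-respects T b≢x b≢y a≢x a≢y) U₁
          | votes-respected (demote T x y) (arc-irreflexive T ab) (demote-respects T a≢x a≢y b≢x b≢y)
                            (demote-respects T b≢x b≢y a≢x a≢y) U₂
    = +-mono-≤ (one-new a b agreeing) old
    where
      agreeing : Above (first T x y) a b ⊎ Above (second T x y) a b
      agreeing with above-total (first T x y) (arc-irreflexive T ab)
      ... | inj₁ ab₁ = inj₁ ab₁
      ... | inj₂ ba₁ = inj₂ (second-reverses T x y x≢y a≢x a≢y b≢x b≢y ba₁)

  add-pair : x ≢ y → arc T x y ≡ true → {P : List (Fin n)} → x ∉ P → y ∉ P → MajorityOn T P U₁ U₂ →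
    MajorityOn T (x ∷ y ∷ P) (first T x y ∷ map (promote T x y) U₁) (second T x y ∷ map (demote T x y) U₂)
  add-pair x≢y xy {P} x∉P y∉P old = majority
    where
      ≢x : ∀ {z} → z ∈ P → z ≢ x
      ≢x z∈ refl = x∉P z∈
      ≢y : ∀ {z} → z ∈ P → z ≢ y
      ≢y z∈ refl = y∉P z∈
      majority : MajorityOn T (x ∷ y ∷ P) (first T x y ∷ map (promote T x y) U₁)
                                          (second T x y ∷ map (demote T x y) U₂)
      majority (here refl) (here refl) xx = contradiction refl (arc-irreflexive T xx)
      majority (there (here refl)) (there (here refl)) yy = contradiction refl (arc-irreflexive T yy)
      majority (there (here refl)) (here refl) yx = contradiction xy (arc-asymmetric T yx)
      majority (here refl) (there (here refl)) _ = enough x y (one-new-and-demoted x y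
        (inj₁ (first-x-above-y T x y x≢y))
        (λ g → lower-bottom y (lower x g) x≢y))
      majority {b = z} (here refl) (there (there z∈)) xz = enough x z (two-new-and-promoted x z
        (first-x-above T x y x≢y (≢x z∈) (≢y z∈)) (second-x-above T x y x≢y (≢x z∈) (≢y z∈) xz)
        (λ g → raise-top x (raise y g) (≢x z∈)))
      majority {b = z} (there (here refl)) (there (there z∈)) yz = enough y z (two-new-and-promoted y z
        (proj₁ (y-above T x y x≢y (≢x z∈) (≢y z∈) yz)) (proj₂ (y-above T x y x≢y (≢x z∈) (≢y z∈) yz))
        (λ g → raise-respects x (x≢y ∘ sym) (≢x z∈) (raise y g) (raise-top y g (≢y z∈))))
      majority {a = z} (there (there z∈)) (here refl) zx = enough z x (one-new-and-demoted z x
        (inj₂ (second-x-below T x y x≢y (≢x z∈) (≢y z∈) (complete T _ x (≢x z∈) zx)))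
        (λ g → lower-respects y (≢y z∈) x≢y (lower x g) (lower-bottom x g (≢x z∈))))
      majority {a = z} (there (there z∈)) (there (here refl)) zy = enough z y (one-new-and-demoted z y
        (y-below T x y x≢y (≢x z∈) (≢y z∈) (complete T _ y (≢y z∈) zy))
        (λ g → lower-bottom y (lower x g) (≢y z∈)))
      majority {a} {b} (there (there a∈)) (there (there b∈)) ab =
        enough a b (old-pair x≢y (≢x a∈) (≢y a∈) (≢x b∈) (≢y b∈) ab (old a∈ b∈ ab))

Majority : Tournament n → List (Score n) → List (Score n) → Set
Majority T U₁ U₂ = ∀ {a b} → arc T a b ≡ true → length U₁ < votes U₁ a b + votes U₂ a b

record Outcome (T : Tournament n) (extra : ℕ) (U₁ U₂ : List (Score n)) : Set where
  field
    V₁ V₂ : List (Score n)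
    balanced : length V₂ ≡ suc (length V₁)
    size : length V₁ + length V₂ ≡ extra + (length U₁ + length U₂)
    majority : Majority T V₁ V₂

two-more : (r : ℕ) {u₁ u₂ v₁ v₂ : ℕ} → v₁ ≡ u₁ → v₂ ≡ u₂ →
  r + (suc v₁ + suc v₂) ≡ suc (suc r) + (u₁ + u₂)
two-more r {u₁} {u₂} refl refl = begin
    r + (suc u₁ + suc u₂)      ≡⟨ cong (r +_) (cong suc (+-suc u₁ u₂)) ⟩
    r + suc (suc (u₁ + u₂))    ≡⟨ +-suc r _ ⟩
    suc (r + suc (u₁ + u₂))    ≡⟨ cong suc (+-suc r _) ⟩
    suc (suc r) + (u₁ + u₂)    ∎
  where open ≡-Reasoning

pair-up : (T : Tournament n) (R P : List (Fin n)) → length R % 2 ≡ 0 → Unique (R ++ P) →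
  (∀ z → z ∈ R ++ P) → {U₁ U₂ : List (Score n)} → length U₂ ≡ suc (length U₁) →
  MajorityOn T P U₁ U₂ → Outcome T (length R) U₁ U₂
pair-up T [] P _ _ covered {U₁} {U₂} balanced majority = record
  { V₁ = U₁ ; V₂ = U₂ ; balanced = balanced ; size = refl
  ; majority = majority (covered _) (covered _) }
pair-up T (x ∷ []) P () _ _ _ _
pair-up {n} T (x ∷ y ∷ R) P even (x≢ ∷ y≢ ∷ unique) covered {U₁} {U₂} balanced majority =
  orient (arc T x y Bool.≟ true)
  where
    x∉P : x ∉ P
    x∉P = All.All¬⇒¬Any (All.++⁻ʳ R (All.tail x≢))
    y∉P : y ∉ P
    y∉P = All.All¬⇒¬Any (All.++⁻ʳ R y≢)
    continue : (p q : Fin n) → p ≢ q → arc T p q ≡ true → p ∉ P → q ∉ P →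
      x ∷ y ∷ R ++ P ↭ p ∷ q ∷ R ++ P → Outcome T (suc (suc (length R))) U₁ U₂
    continue p q p≢q pq p∉P q∉P π = record
      { V₁ = V₁ ; V₂ = V₂ ; balanced = balanced′ ; majority = majority′
      ; size = trans size (two-more (length R) (length-map (promote T p q) U₁)
                                                (length-map (demote T p q) U₂)) }
      where
        rearranged : x ∷ y ∷ R ++ P ↭ R ++ p ∷ q ∷ P
        rearranged = ↭-trans π (↭-sym (shifts R (p ∷ q ∷ [])))
        open Outcome (pair-up T R (p ∷ q ∷ P) even
          (unique-resp-↭ rearranged (x≢ ∷ y≢ ∷ unique)) (∈-resp-↭ rearranged ∘ covered)
          {first T p q ∷ map (promote T p q) U₁} {second T p q ∷ map (demote T p q) U₂}
          (cong suc (trans (length-map (demote T p q) U₂)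
                           (trans balanced (cong suc (sym (length-map (promote T p q) U₁))))))
          (add-pair T {p} {q} {U₁} {U₂} balanced p≢q pq p∉P q∉P majority))
          renaming (balanced to balanced′; majority to majority′)
    orient : Dec (arc T x y ≡ true) → Outcome T (suc (suc (length R))) U₁ U₂
    orient (yes xy) = continue x y (All.head x≢) xy x∉P y∉P ↭-refl
    orient (no ¬xy) =
      continue y x (All.head x≢ ∘ sym) (arc-converse T (All.head x≢) ¬xy) y∉P x∉P (↭-swap x y ↭-refl)

majority⇒doubled : {m c : ℕ} → m < c → m + suc m < 2 * c
majority⇒doubled {m} {c} m<c = begin-strict
    m + suc m  <⟨ +-monoˡ-< (suc m) m<c ⟩
    c + suc m  ≤⟨ +-monoʳ-≤ c (≤-trans m<c (≤-reflexive (sym (+-identityʳ c)))) ⟩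
    2 * c      ∎
  where open ≤-Reasoning

doubled⇒majority : {m c : ℕ} → m + suc m < 2 * c → m < c
doubled⇒majority {m} {c} h with m <? c
... | yes m<c = m<c
... | no m≮c = contradiction h (<⇒≱ (s≤s (begin
      2 * c       ≡⟨ cong (c +_) (+-identityʳ c) ⟩
      c + c       ≤⟨ +-mono-≤ (≮⇒≥ m≮c) (≮⇒≥ m≮c) ⟩
      m + m       ≤⟨ +-monoʳ-≤ m (n≤1+n m) ⟩
      m + suc m   ∎)))
  where open ≤-Reasoning

generates : (T : Tournament n) {U₁ U₂ : List (Score n)} → length U₂ ≡ suc (length U₁) →
  Majority T U₁ U₂ → Generates (map toVoter (U₁ ++ U₂)) T
generates T {U₁} {U₂} balanced majority = nonempty , λ a b a≢b → mk⇔ (to a≢b) (from a≢b)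
  where
    m = length U₁
    U = map toVoter (U₁ ++ U₂)
    size : length U ≡ m + suc m
    size = trans (length-map toVoter (U₁ ++ U₂)) (trans (length-++ U₁) (cong (m +_) balanced))
    tally : (a b : Fin _) → count U a b ≡ votes U₁ a b + votes U₂ a b
    tally a b = trans (count-toVoter (U₁ ++ U₂) a b) (votes-++ U₁ U₂ a b)
    nonempty : 0 < length U
    nonempty = subst (0 <_) (sym (trans size (+-suc m m))) (s≤s z≤n)
    to : {a b : Fin _} → a ≢ b → arc T a b ≡ true → length U < 2 * count U a b
    to {a} {b} _ ab =
      subst₂ (λ l c → l < 2 * c) (sym size) (sym (tally a b)) (majority⇒doubled (majority ab))
    from : {a b : Fin _} → a ≢ b → length U < 2 * count U a b → arc T a b ≡ true
    from {a} {b} a≢b h with arc T a b Bool.≟ true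
    ... | yes ab = ab
    ... | no ¬ab =
      contradiction (+-mono-≤ m<ab m<ba) (<⇒≱ (subst (_< suc m + suc m) (sym both-ways) (n<1+n _)))
      where
        m<ab : m < votes U₁ a b + votes U₂ a b
        m<ab = doubled⇒majority (subst₂ (λ l c → l < 2 * c) size (tally a b) h)
        m<ba : m < votes U₁ b a + votes U₂ b a
        m<ba = majority (arc-converse T a≢b ¬ab)
        both-ways : (votes U₁ a b + votes U₂ a b) + (votes U₁ b a + votes U₂ b a) ≡ m + suc m
        both-ways = trans (+-interchange (votes U₁ a b) _ _ _)
                  (cong₂ _+_ (votes-complement U₁ a≢b) (trans (votes-complement U₂ a≢b) balanced))

odd-offset-even : ∀ r j → (r + suc j) % 2 ≢ j % 2 → r % 2 ≡ 0
odd-offset-even zero          j _ = refl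
odd-offset-even (suc zero)    j h = contradiction refl h
odd-offset-even (suc (suc r)) j h = odd-offset-even r j h

generated-by : (T : Tournament n) (j : ℕ) → 2 ^ j ≤ n → n % 2 ≢ j % 2 →
  ∃ λ (U : List (Voter n)) → Generates U T × length U ≡ n ∸ j
generated-by {n} T j 2^j≤n parity =
  map toVoter (V₁ ++ V₂) , generates T {V₁} {V₂} balanced majority , size′
  where
    part : TransitivePart T (allFin n) (suc j)
    part = transitive-part T j (allFin n) (Unique.allFin⁺ n) (subst (2 ^ j ≤_) (sym (length-tabulate id)) 2^j≤n)
    open TransitivePart part
    r = length others
    enumerates : others ++ chosen ↭ allFin n
    enumerates = ↭-trans (++-comm others chosen) splits
    r+j+1≡n : r + suc j ≡ n
    r+j+1≡n = begin
      r + suc j                       ≡⟨ +-comm r _ ⟩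
      suc j + r                       ≡⟨ cong (_+ r) (sym chosen-size) ⟩
      length chosen + r               ≡⟨ sym (length-++ chosen) ⟩
      length (chosen ++ others)       ≡⟨ ↭-length splits ⟩
      length (allFin n)               ≡⟨ length-tabulate id ⟩
      n                               ∎
      where open ≡-Reasoning
    initial : MajorityOn T chosen [] (voter ∷ [])
    initial a∈ b∈ ab rewrite vote-yes voter (agrees a∈ b∈ ab) = s≤s z≤n
    open Outcome (pair-up T others chosen
      (odd-offset-even r j (subst (λ m → m % 2 ≢ j % 2) (sym r+j+1≡n) parity))
      (unique-resp-↭ (↭-sym enumerates) (Unique.allFin⁺ n))
      (λ z → ∈-resp-↭ (↭-sym enumerates) (∈-allFin z)) {[]} {voter ∷ []} refl initial)
    size′ : length (map toVoter (V₁ ++ V₂)) ≡ n ∸ j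
    size′ = begin
      length (map toVoter (V₁ ++ V₂))  ≡⟨ length-map toVoter (V₁ ++ V₂) ⟩
      length (V₁ ++ V₂)                ≡⟨ length-++ V₁ ⟩
      length V₁ + length V₂            ≡⟨ size ⟩
      r + 1                            ≡⟨ sym (m+n∸n≡m (r + 1) j) ⟩
      r + 1 + j ∸ j                    ≡⟨ cong (_∸ j) (trans (+-assoc r 1 j) r+j+1≡n) ⟩
      n ∸ j                            ∎
      where open ≡-Reasoning

2^⌊log₂⌋≤ : ∀ n → 1 ≤ n → 2 ^ ⌊log₂ n ⌋ ≤ n
2^⌊log₂⌋≤ _ = go _ (<-wellFounded _)
  where
    go : ∀ n → Acc _<_ n → 1 ≤ n → 2 ^ ⌊log₂ n ⌋ ≤ n
    go (suc zero)    _         _ = ≤-refl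
    go N@(suc (suc m)) (acc rec) _ = begin
      2 ^ ⌊log₂ N ⌋              ≡⟨ cong (2 ^_) (sym log-half) ⟩
      2 * 2 ^ ⌊log₂ ⌊ N /2⌋ ⌋    ≤⟨ *-monoʳ-≤ 2 (go ⌊ N /2⌋ (rec (⌊n/2⌋<n (suc m))) (s≤s z≤n)) ⟩
      2 * ⌊ N /2⌋                ≡⟨ cong (⌊ N /2⌋ +_) (+-identityʳ _) ⟩
      ⌊ N /2⌋ + ⌊ N /2⌋          ≤⟨ +-monoʳ-≤ ⌊ N /2⌋ (⌊n/2⌋≤⌈n/2⌉ N) ⟩
      ⌊ N /2⌋ + ⌈ N /2⌉          ≡⟨ ⌊n/2⌋+⌈n/2⌉≡n N ⟩
      N                          ∎
      where
        open ≤-Reasoning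
        log-half : suc ⌊log₂ ⌊ N /2⌋ ⌋ ≡ ⌊log₂ N ⌋
        log-half = trans (cong suc (⌊log₂⌊n/2⌋⌋≡⌊log₂n⌋∸1 N))
                         (trans (+-comm 1 _) (m∸n+n≡m (⌊log₂⌋-mono-≤ {2} {N} (s≤s (s≤s z≤n)))))

∸-pred-≤ : ∀ n k → n ∸ (k ∸ 1) ≤ n ∸ k + 1
∸-pred-≤ n             zero          = m≤m+n n 1
∸-pred-≤ zero          (suc k)       = ≤-trans (≤-reflexive (0∸n≡0 k)) z≤n
∸-pred-≤ (suc n)       (suc zero)    = ≤-reflexive (+-comm 1 n)
∸-pred-≤ (suc n)       (suc (suc k)) = ∸-pred-≤ n (suc k)

suc-parity-≢ : ∀ j → suc j % 2 ≢ j % 2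
suc-parity-≢ zero          ()
suc-parity-≢ (suc zero)    ()
suc-parity-≢ (suc (suc j)) = suc-parity-≢ j

mainTheorem3 : (n : ℕ) → 2 ≤ n →
    (n % 2 ≢ ⌊log₂ n ⌋ % 2 →
      (T : Tournament n) → ∃ λ (U : List (Voter n)) → Generates U T × length U ≤ n ∸ ⌊log₂ n ⌋)
    × (n % 2 ≡ ⌊log₂ n ⌋ % 2 →
      (T : Tournament n) → ∃ λ (U : List (Voter n)) → Generates U T × length U ≤ n ∸ ⌊log₂ n ⌋ + 1)
mainTheorem3 n 2≤n = different-parity , same-parity
  where
    k = ⌊log₂ n ⌋
    1≤k : 1 ≤ k
    1≤k = ⌊log₂⌋-mono-≤ 2≤n
    2^k≤n : 2 ^ k ≤ n
    2^k≤n = 2^⌊log₂⌋≤ n (≤-trans (s≤s z≤n) 2≤n)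
    different-parity : n % 2 ≢ k % 2 → (T : Tournament n) →
      ∃ λ (U : List (Voter n)) → Generates U T × length U ≤ n ∸ k
    different-parity parity T = map₂ (map₂ ≤-reflexive) (generated-by T k 2^k≤n parity)
    same-parity : n % 2 ≡ k % 2 → (T : Tournament n) →
      ∃ λ (U : List (Voter n)) → Generates U T × length U ≤ n ∸ k + 1
    same-parity parity T = map₂ (map₂ (λ size → ≤-trans (≤-reflexive size) (∸-pred-≤ n k)))
      (generated-by T (k ∸ 1) (≤-trans (^-monoʳ-≤ 2 (m∸n≤m k 1)) 2^k≤n) parity′)
      where
        parity′ : n % 2 ≢ (k ∸ 1) % 2
        parity′ eq = suc-parity-≢ (k ∸ 1)
          (trans (cong (_% 2) (trans (+-comm 1 (k ∸ 1)) (m∸n+n≡m 1≤k))) (trans (sym parity) eq))
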